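{- For all integers $n\ge 2$ and $0\leq k\leq n$, $$b_{n,k}^+=2k\,b_{n-1,k}^-+(2n-2k+1)\,b_{n-1,k-1}^-+b_{n-1,k}^+,\qquad b_{n,k}^-=2k\,b_{n-1,k}^++(2n-2k+1)\,b_{n-1,k-1}^++b_{n-1,k}^-,$$ with the convention $b_{n-1,j}^{\pm}=0$ for $j<0$ or $j>n-1$.
   Context: $\mathfrak{B}_n$ is the group of signed permutations: bijections $\pi$ of $\{\pm1,\dots,\pm n\}$ with $\pi(-i)=-\pi(i)$; write $\pi_i=\pi(i)$ and $\pi_0=0$. $\mathsf{inv}_B(\pi)=|\{1\le i<j\le n:\pi_i>\pi_j\}|+|\{1\le i<j\le n:-\pi_i>\pi_j\}|+|\{i\in[n]:\pi_i<0\}|$; $\mathfrak{B}_n^+$ is the set of $\pi$ with $\mathsf{inv}_B(\pi)$ even, $\mathfrak{B}_n^-=\mathfrak{B}_n\setminus\mathfrak{B}_n^+$. $\mathsf{des}_B(\pi)=|\{i\in\{0,\dots,n-1\}:\pi_i>\pi_{i+1}\}|$. $b_{n,k}^{\pm}$ is the number of $\pi\in\mathfrak{B}_n^{\pm}$ with $\mathsf{des}_B(\pi)=k$. -}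

module Defs where

open import Data.Bool using (Bool; true; false; if_then_else_; _∧_; not)
open import Data.Nat as ℕ using (ℕ; zero; suc; _+_; _*_; _%_)
open import Data.Integer as ℤ using (ℤ; +_; -_; ∣_∣)
import Data.Integer.Properties as ℤP
import Data.Nat.Properties as ℕP
open import Data.List using (List; []; _∷_; map; filter; length; concatMap; applyUpTo; _++_)
open import Relation.Nullary.Decidable using (⌊_⌋)

-- A signed permutation π ∈ 𝔅_n is determined by its window [π_1,…,π_n]
-- (since π(-i) = -π(i)); the window is a word of length n over
-- {±1,…,±n} whose absolute values are pairwise distinct.

alphabet : ℕ → List ℤ
alphabet n = applyUpTo (λ i → + suc i) n ++ applyUpTo (λ i → - (+ suc i)) n

words : ℕ → List ℤ → List (List ℤ)
words zero    A = [] ∷ []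
words (suc m) A = concatMap (λ a → map (a ∷_) (words m A)) A

notIn : ℕ → List ℕ → Bool
notIn x []       = true
notIn x (y ∷ ys) = not ⌊ x ℕ.≟ y ⌋ ∧ notIn x ys

distinct : List ℕ → Bool
distinct []       = true
distinct (x ∷ xs) = notIn x xs ∧ distinct xs

signedPerms : ℕ → List (List ℤ)
signedPerms n = filter (λ w → distinct (map ∣_∣ w) Data.Bool.≟ true) (words n (alphabet n))
  where import Data.Bool

countB : (ℤ → Bool) → List ℤ → ℕ
countB p []       = 0
countB p (y ∷ ys) = (if p y then 1 else 0) + countB p ys

invB : List ℤ → ℕ
invB []       = 0
invB (x ∷ xs) =
  countB (λ y → ⌊ y ℤP.<? x ⌋) xs
  + countB (λ y → ⌊ y ℤP.<? - x ⌋) xs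
  + (if ⌊ x ℤP.<? + 0 ⌋ then 1 else 0)
  + invB xs

descents : List ℤ → ℕ
descents []           = 0
descents (x ∷ [])     = 0
descents (x ∷ y ∷ ys) = (if ⌊ y ℤP.<? x ⌋ then 1 else 0) + descents (y ∷ ys)

desB : List ℤ → ℕ
desB w = descents (+ 0 ∷ w)

isEven : ℕ → Bool
isEven m = ⌊ m % 2 ℕ.≟ 0 ⌋

-- b_{n,j}^{s}: number of π ∈ 𝔅_n^{s} with des_B(π) = j  (j ∈ ℤ, so that
-- b_{n,j} = 0 for j < 0 holds by definition; it is also 0 for j > n)
b : Bool → ℕ → ℤ → ℕ
b s n j = length (filter (λ w → (isEven (invB w) Data.Bool.≟ s) ×-dec (+ desB w ℤ.≟ j)) (signedPerms n))
  where
    import Data.Bool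
    open import Relation.Nullary.Decidable using (_×-dec_)

b⁺ b⁻ : ℕ → ℤ → ℕ
b⁺ = b true
b⁻ = b false

-- Every signed permutation of [m+1] arises exactly once by inserting m+1 or -(m+1) into one of the
-- m+1 gaps of a signed permutation w of [m] (the gaps after 0 = π₀, π₁, …, π_m). At a gap that is
-- a descent of 0 ∷ w both choices keep des_B, at an ascent both raise it by one, and the two
-- choices have opposite inv_B parity; at the end, m+1 keeps both statistics while -(m+1) adds a
-- descent and flips the parity. Summing over w gives
--   b^s_{m+1,k} = k e_{m,k} + b^s_{m,k} + (m+1-k) e_{m,k-1} + b^{-s}_{m,k-1},   e = b⁺ + b⁻.
-- By the same recurrence (-1)^k (b⁺_{m,k} - b⁻_{m,k}) obeys Pascal's rule, so it equals C(m,k),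
-- and k C(m,k) = (m+1-k) C(m,k-1) turns the recurrence into the stated one.

module Submission where

open import Defs
open import Data.Bool using (Bool; true; false; not; _∧_; T)
import Data.Bool as Bool
open import Data.Bool.Properties using (∧-identityʳ; ∧-zeroʳ; not-involutive)
open import Data.Empty using (⊥-elim)
open import Data.Integer as ℤ using (ℤ; +_; -[1+_]; -_; ∣_∣; _-_)
import Data.Integer.Properties as ℤ
open import Data.List using (List; []; _∷_; map; length; _++_; filter; concatMap; applyUpTo)
import Data.List.Properties as List
open import Data.List.Membership.Propositional using (_∈_; find)
open import Data.List.Membership.Propositional.Properties
  using (∈-map⁻; ∈-map⁺; ∈-concatMap⁻; ∈-concatMap⁺; ∈-++⁻; ∈-++⁺ˡ; ∈-++⁺ʳ; ∈-applyUpTo⁻; ∈-applyUpTo⁺; ∈-filter⁻; ∈-filter⁺; ∈-∃++)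
open import Data.List.Relation.Binary.Permutation.Propositional as ↭ using (_↭_; ↭-sym; ↭⇒↭ₛ)
open import Data.List.Relation.Binary.Permutation.Propositional.Properties as ↭
  using (shift; All-resp-↭; ↭-length)
import Data.List.Relation.Binary.Permutation.Setoid.Properties as ↭ₛ
open import Data.List.Membership.Propositional.Properties.WithK using (unique∧set⇒bag)
open import Data.List.Relation.Binary.BagAndSetEquality using (∼bag⇒↭)
open import Data.List.Relation.Unary.All as All using (All; []; _∷_)
import Data.List.Relation.Unary.All.Properties as All
open import Data.List.Relation.Unary.Any as Any using (here; there)
open import Data.List.Relation.Unary.AllPairs using ([]; _∷_)
open import Data.List.Relation.Unary.Unique.Propositional using (Unique)
import Data.List.Relation.Unary.Unique.Propositional.Properties as Unique
open import Data.Nat as ℕ using (ℕ; zero; suc; _+_; _*_; _∸_; _≤_; z≤n; s≤s; _≡ᵇ_)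
import Data.Nat.Properties as ℕ
open import Data.Nat.Combinatorics using (_C_; nCk+nC[k+1]≡[n+1]C[k+1]; nC1≡n; k>n⇒nCk≡0)
open import Data.Nat.DivMod using ([m+kn]%n≡m%n)
open import Data.Nat.Tactic.RingSolver using (solve-∀)
open import Algebra.Properties.CommutativeSemigroup ℕ.+-commutativeSemigroup using (interchange; x∙yz≈y∙xz)
open import Data.Sum using (_⊎_; inj₁; inj₂)
open import Data.Product using (∃; _×_; _,_; proj₁; proj₂)
open import Function using (_∘_; mk⇔)
open import Relation.Binary.PropositionalEquality
open import Relation.Nullary using (Dec; yes; no; ¬_; ¬?; does)
open import Relation.Nullary.Decidable using (isYes; isYes≗does; dec-true; dec-false)
open import Relation.Unary using (Decidable)

𝟙 : Bool → ℕ
𝟙 b = Bool.if b then 1 else 0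

module _ {A : Set} where

  sumBy : (A → ℕ) → List A → ℕ
  sumBy f []       = 0
  sumBy f (x ∷ xs) = f x + sumBy f xs

  count : (A → Bool) → List A → ℕ
  count p = sumBy (𝟙 ∘ p)

  sumBy-++ : ∀ f xs ys → sumBy f (xs ++ ys) ≡ sumBy f xs + sumBy f ys
  sumBy-++ f []       ys = refl
  sumBy-++ f (x ∷ xs) ys = trans (cong (_+_ (f x)) (sumBy-++ f xs ys)) (sym (ℕ.+-assoc (f x) _ _))

  sumBy-cong : ∀ {f g} xs → (∀ {x} → x ∈ xs → f x ≡ g x) → sumBy f xs ≡ sumBy g xs
  sumBy-cong []       eq = refl
  sumBy-cong (x ∷ xs) eq = cong₂ _+_ (eq (here refl)) (sumBy-cong xs (eq ∘ there))

  sumBy-+ : ∀ f g xs → sumBy (λ x → f x + g x) xs ≡ sumBy f xs + sumBy g xs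
  sumBy-+ f g []       = refl
  sumBy-+ f g (x ∷ xs) = trans (cong (_+_ (f x + g x)) (sumBy-+ f g xs)) (interchange (f x) (g x) _ _)

  sumBy-*ˡ : ∀ c f xs → sumBy (λ x → c * f x) xs ≡ c * sumBy f xs
  sumBy-*ˡ c f []       = sym (ℕ.*-zeroʳ c)
  sumBy-*ˡ c f (x ∷ xs) = trans (cong (_+_ (c * f x)) (sumBy-*ˡ c f xs)) (sym (ℕ.*-distribˡ-+ c (f x) _))

  sumBy-↭ : ∀ f {xs ys} → xs ↭ ys → sumBy f xs ≡ sumBy f ys
  sumBy-↭ f ↭.refl         = refl
  sumBy-↭ f (↭.prep x p)   = cong (_+_ (f x)) (sumBy-↭ f p)
  sumBy-↭ f {_ ∷ _ ∷ xs} (↭.swap x y p) =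
    trans (x∙yz≈y∙xz (f x) (f y) (sumBy f xs)) (cong (λ s → f y + (f x + s)) (sumBy-↭ f p))
  sumBy-↭ f (↭.trans p q) = trans (sumBy-↭ f p) (sumBy-↭ f q)

  count-false : ∀ p xs → (∀ x → p x ≡ false) → count p xs ≡ 0
  count-false p []       _  = refl
  count-false p (x ∷ xs) px rewrite px x = count-false p xs px

  length-filter : ∀ {P : A → Set} (P? : Decidable P) xs → length (filter P? xs) ≡ count (does ∘ P?) xs
  length-filter P? []       = refl
  length-filter P? (x ∷ xs) with P? x
  ... | yes _ = cong suc (length-filter P? xs)
  ... | no  _ = length-filter P? xs

sumBy-map : ∀ {A B : Set} (f : B → ℕ) (g : A → B) xs → sumBy f (map g xs) ≡ sumBy (f ∘ g) xs
sumBy-map f g []       = refl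
sumBy-map f g (x ∷ xs) = cong (_+_ (f (g x))) (sumBy-map f g xs)

sumBy-concatMap : ∀ {A B : Set} (f : B → ℕ) (g : A → List B) xs →
                  sumBy f (concatMap g xs) ≡ sumBy (sumBy f ∘ g) xs
sumBy-concatMap f g []       = refl
sumBy-concatMap f g (x ∷ xs) =
  trans (sumBy-++ f (g x) (concatMap g xs)) (cong (_+_ (sumBy f (g x))) (sumBy-concatMap f g xs))

𝟙-∧ : ∀ b q → 𝟙 (b ∧ q) ≡ 𝟙 q * 𝟙 b
𝟙-∧ false q = sym (ℕ.*-zeroʳ (𝟙 q))
𝟙-∧ true  q = sym (ℕ.*-identityʳ (𝟙 q))

𝟙-≡ᵇ-weight : ∀ (f : ℕ → ℕ) d k q → 𝟙 (d ≡ᵇ k) * (f d + 𝟙 q) ≡ f k * 𝟙 (d ≡ᵇ k) + 𝟙 (q ∧ (d ≡ᵇ k))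
𝟙-≡ᵇ-weight f d k q with d ≡ᵇ k in d≡ᵇk
... | false = cong₂ _+_ (sym (ℕ.*-zeroʳ (f k))) (cong 𝟙 (sym (∧-zeroʳ q)))
... | true rewrite ℕ.≡ᵇ⇒≡ d k (subst T (sym d≡ᵇk) _) =
  trans (ℕ.+-identityʳ _) (cong₂ _+_ (sym (ℕ.*-identityʳ (f k))) (cong 𝟙 (sym (∧-identityʳ q))))

sumBy-≡ᵇ-weight : ∀ {A : Set} (d : A → ℕ) (f : ℕ → ℕ) (q : A → Bool) k xs →
  sumBy (λ w → 𝟙 (d w ≡ᵇ k) * (f (d w) + 𝟙 (q w))) xs ≡ f k * count (λ w → d w ≡ᵇ k) xs + count (λ w → q w ∧ (d w ≡ᵇ k)) xs
sumBy-≡ᵇ-weight d f q k xs = begin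
  sumBy (λ w → 𝟙 (d w ≡ᵇ k) * (f (d w) + 𝟙 (q w))) xs
    ≡⟨ sumBy-cong xs (λ {w} _ → 𝟙-≡ᵇ-weight f (d w) k (q w)) ⟩
  sumBy (λ w → f k * 𝟙 (d w ≡ᵇ k) + 𝟙 (q w ∧ (d w ≡ᵇ k))) xs
    ≡⟨ sumBy-+ _ _ xs ⟩
  sumBy (λ w → f k * 𝟙 (d w ≡ᵇ k)) xs + count (λ w → q w ∧ (d w ≡ᵇ k)) xs
    ≡⟨ cong (_+ count (λ w → q w ∧ (d w ≡ᵇ k)) xs) (sumBy-*ˡ (f k) _ xs) ⟩
  f k * count (λ w → d w ≡ᵇ k) xs + count (λ w → q w ∧ (d w ≡ᵇ k)) xs ∎
  where open ≡-Reasoning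

module _ {A : Set} where

  Unique-resp-↭ : ∀ {xs ys : List A} → xs ↭ ys → Unique xs → Unique ys
  Unique-resp-↭ p = ↭ₛ.Unique-resp-↭ (setoid A) (↭⇒↭ₛ p)

  Unique-concatMap⁺ : ∀ {B : Set} (f : A → List B) (r : B → A) {xs} → Unique xs →
                      (∀ {x} → x ∈ xs → Unique (f x)) → (∀ {x v} → x ∈ xs → v ∈ f x → r v ≡ x) →
                      Unique (concatMap f xs)
  Unique-concatMap⁺ f r {[]}     []         _ _ = []
  Unique-concatMap⁺ f r {x ∷ xs} (x∉ ∷ uxs) u ret =
    Unique.++⁺ (u (here refl)) (Unique-concatMap⁺ f r uxs (u ∘ there) (ret ∘ there)) disjoint
    where
    disjoint : ∀ {v} → ¬ (v ∈ f x × v ∈ concatMap f xs)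
    disjoint (v∈fx , v∈rest) with find (∈-concatMap⁻ f {xs = xs} v∈rest)
    ... | x′ , x′∈xs , v∈fx′ = All.lookup x∉ x′∈xs (trans (sym (ret (here refl) v∈fx)) (ret (there x′∈xs) v∈fx′))

private
  narrow : ∀ {K ms} → All (suc K ≢_) ms → All (λ n → 1 ≤ n × n ≤ suc K) ms → All (λ n → 1 ≤ n × n ≤ K) ms
  narrow ≢ms inRange = All.zipWith (λ (≢n , 1≤n , n≤) → 1≤n , ℕ.≤-pred (ℕ.≤∧≢⇒< n≤ (≢n ∘ sym))) (≢ms , inRange)

pigeonhole : ∀ K {ns} → Unique ns → All (λ n → 1 ≤ n × n ≤ K) ns → length ns ≤ K
pigeonhole zero    {[]}    _ _                 = z≤n
pigeonhole zero    {_ ∷ _} _ ((1≤n , n≤0) ∷ _) = ⊥-elim (ℕ.<-irrefl refl (ℕ.≤-trans 1≤n n≤0))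
pigeonhole (suc K) {ns}    u inRange with suc K ∈? ns
  where open import Data.List.Membership.DecPropositional ℕ._≟_ using (_∈?_)
... | no K+1∉ =
  ℕ.m≤n⇒m≤1+n (pigeonhole K u (narrow (All.tabulate λ n∈ K+1≡n → K+1∉ (subst (_∈ ns) (sym K+1≡n) n∈)) inRange))
... | yes K+1∈ with ∈-∃++ K+1∈
... | pre , post , refl with Unique-resp-↭ (shift (suc K) pre post) u | All-resp-↭ (shift (suc K) pre post) inRange
... | K+1∉ ∷ u′ | _ ∷ inRange′ =
  subst (_≤ suc K) (sym (↭-length (shift (suc K) pre post))) (s≤s (pigeonhole K u′ (narrow K+1∉ inRange′)))

isEven-+2 : ∀ n → isEven (2 + n) ≡ isEven n
isEven-+2 n = cong (λ r → isYes (r ℕ.≟ 0)) (trans (cong (ℕ._% 2) (ℕ.+-comm 2 n)) ([m+kn]%n≡m%n n 1 2))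

isEven-suc : ∀ n → isEven (suc n) ≡ not (isEven n)
isEven-suc zero    = refl
isEven-suc (suc n) = trans (isEven-+2 n) (trans (sym (not-involutive (isEven n))) (cong not (sym (isEven-suc n))))

isEven-+2* : ∀ n t → isEven (n + 2 * t) ≡ isEven n
isEven-+2* n zero    = cong isEven (ℕ.+-identityʳ n)
isEven-+2* n (suc t) = trans (cong isEven (shuffle n t)) (trans (isEven-+2 (n + 2 * t)) (isEven-+2* n t))
  where
  shuffle : ∀ n t → n + 2 * suc t ≡ 2 + (n + 2 * t)
  shuffle = solve-∀

isEven-+suc : ∀ c n → isEven (c + suc n) ≡ not (isEven (c + n))
isEven-+suc c n = trans (cong isEven (ℕ.+-suc c n)) (isEven-suc (c + n))

-- Signed permutations as lists

Bounded : ℕ → ℤ → Set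
Bounded m x = ∣ x ∣ ≤ m

InRange : ℕ → ℤ → Set
InRange n x = 1 ≤ ∣ x ∣ × Bounded n x

IsSignedPerm : ℕ → List ℤ → Set
IsSignedPerm n v = length v ≡ n × All (InRange n) v × Unique (map ∣_∣ v)

∈-alphabet⁻ : ∀ n {x} → x ∈ alphabet n → InRange n x
∈-alphabet⁻ n x∈ with ∈-++⁻ (applyUpTo (λ i → + suc i) n) x∈
... | inj₁ x∈⁺ with ∈-applyUpTo⁻ (λ i → + suc i) x∈⁺
...   | _ , i<n , refl = s≤s z≤n , i<n
∈-alphabet⁻ n x∈ | inj₂ x∈⁻ with ∈-applyUpTo⁻ (λ i → - (+ suc i)) x∈⁻
...   | _ , i<n , refl = s≤s z≤n , i<n

∈-alphabet⁺ : ∀ n {x} → InRange n x → x ∈ alphabet n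
∈-alphabet⁺ n {+ suc i}  (_ , i<n) = ∈-++⁺ˡ (∈-applyUpTo⁺ (λ i → + suc i) i<n)
∈-alphabet⁺ n { -[1+ i ]} (_ , i<n) = ∈-++⁺ʳ (applyUpTo (λ i → + suc i) n) (∈-applyUpTo⁺ (λ i → - (+ suc i)) i<n)

alphabet-unique : ∀ n → Unique (alphabet n)
alphabet-unique n = Unique.++⁺
  (Unique.applyUpTo⁺₁ _ n λ i<j _ eq → ℕ.<⇒≢ i<j (ℕ.suc-injective (ℤ.+-injective eq)))
  (Unique.applyUpTo⁺₁ _ n λ i<j _ eq → ℕ.<⇒≢ i<j (ℤ.-[1+-injective eq))
  disjoint
  where
  disjoint : ∀ {x} → ¬ (x ∈ applyUpTo (λ i → + suc i) n × x ∈ applyUpTo (λ i → - (+ suc i)) n)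
  disjoint (x∈⁺ , x∈⁻) with ∈-applyUpTo⁻ _ x∈⁺ | ∈-applyUpTo⁻ _ x∈⁻
  ... | _ , _ , refl | _ , _ , ()

∈-words⁻ : ∀ n A {v} → v ∈ words n A → length v ≡ n × All (_∈ A) v
∈-words⁻ zero    A (here refl) = refl , []
∈-words⁻ (suc n) A v∈ with find (∈-concatMap⁻ (λ a → map (a ∷_) (words n A)) {xs = A} v∈)
... | a , a∈A , v∈aw with ∈-map⁻ (a ∷_) v∈aw
... | v′ , v′∈ , refl with ∈-words⁻ n A v′∈
... | |v′|≡n , v′⊆A = cong suc |v′|≡n , a∈A ∷ v′⊆A

∈-words⁺ : ∀ n A {v} → length v ≡ n → All (_∈ A) v → v ∈ words n A
∈-words⁺ zero    A {[]}    refl []          = here refl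
∈-words⁺ (suc n) A {a ∷ v} refl (a∈A ∷ v⊆A) =
  ∈-concatMap⁺ (λ a → map (a ∷_) (words n A)) (Any.map (λ { refl → ∈-map⁺ (a ∷_) (∈-words⁺ n A refl v⊆A) }) a∈A)

words-unique : ∀ n A → Unique A → Unique (words n A)
words-unique zero    A _ = [] ∷ []
words-unique (suc n) A u =
  Unique-concatMap⁺ (λ a → map (a ∷_) (words n A)) head u
    (λ _ → Unique.map⁺ List.∷-injectiveʳ (words-unique n A u))
    (λ _ v∈ → head-∷ v∈)
  where
  head : List ℤ → ℤ
  head []      = + 0
  head (x ∷ _) = x
  head-∷ : ∀ {a v} → v ∈ map (a ∷_) (words n A) → head v ≡ a
  head-∷ v∈ with ∈-map⁻ _ v∈
  ... | _ , _ , refl = refl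

notIn⁻ : ∀ x ys → notIn x ys ≡ true → All (x ≢_) ys
notIn⁻ x []       _  = []
notIn⁻ x (y ∷ ys) eq with x ℕ.≟ y
... | no x≢y = x≢y ∷ notIn⁻ x ys eq

notIn⁺ : ∀ x ys → All (x ≢_) ys → notIn x ys ≡ true
notIn⁺ x []       _           = refl
notIn⁺ x (y ∷ ys) (x≢y ∷ x∉) with x ℕ.≟ y
... | yes x≡y = ⊥-elim (x≢y x≡y)
... | no  _   = notIn⁺ x ys x∉

distinct⁻ : ∀ xs → distinct xs ≡ true → Unique xs
distinct⁻ []       _  = []
distinct⁻ (x ∷ xs) eq with notIn x xs in x∉
... | true = notIn⁻ x xs x∉ ∷ distinct⁻ xs eq

distinct⁺ : ∀ xs → Unique xs → distinct xs ≡ true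
distinct⁺ []       _          = refl
distinct⁺ (x ∷ xs) (x∉ ∷ u) rewrite notIn⁺ x xs x∉ = distinct⁺ xs u

private
  distinct? : (w : List ℤ) → Dec (distinct (map ∣_∣ w) ≡ true)
  distinct? w = distinct (map ∣_∣ w) Bool.≟ true

∈-signedPerms⁻ : ∀ n {v} → v ∈ signedPerms n → IsSignedPerm n v
∈-signedPerms⁻ n {v} v∈ with ∈-filter⁻ distinct? {xs = words n (alphabet n)} v∈
... | v∈words , d with ∈-words⁻ n (alphabet n) v∈words
... | |v|≡n , v⊆alphabet = |v|≡n , All.map (∈-alphabet⁻ n) v⊆alphabet , distinct⁻ (map ∣_∣ v) d

∈-signedPerms⁺ : ∀ n {v} → IsSignedPerm n v → v ∈ signedPerms n
∈-signedPerms⁺ n {v} (|v|≡n , inRange , u) = ∈-filter⁺ distinct? {xs = words n (alphabet n)}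
  (∈-words⁺ n (alphabet n) |v|≡n (All.map (∈-alphabet⁺ n) inRange)) (distinct⁺ (map ∣_∣ v) u)

signedPerms-unique : ∀ n → Unique (signedPerms n)
signedPerms-unique n = Unique.filter⁺ distinct? (words-unique n (alphabet n) (alphabet-unique n))

IsSignedPerm-resp-↭ : ∀ {n v v′} → v ↭ v′ → IsSignedPerm n v → IsSignedPerm n v′
IsSignedPerm-resp-↭ p (|v|≡n , inRange , u) =
  trans (sym (↭-length p)) |v|≡n , All-resp-↭ p inRange , Unique-resp-↭ (↭.map⁺ ∣_∣ p) u

IsSignedPerm-∷⁻ : ∀ {m y w} → ∣ y ∣ ≡ suc m → IsSignedPerm (suc m) (y ∷ w) → IsSignedPerm m w
IsSignedPerm-∷⁻ {m} {w = w} ∣y∣≡ (|yw|≡ , _ ∷ inRange , y∉ ∷ u) =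
  ℕ.suc-injective |yw|≡ , All.map⁻ (narrow (subst (λ a → All (a ≢_) (map ∣_∣ w)) ∣y∣≡ y∉) (All.map⁺ inRange)) , u

IsSignedPerm-∷⁺ : ∀ {m y w} → ∣ y ∣ ≡ suc m → IsSignedPerm m w → IsSignedPerm (suc m) (y ∷ w)
IsSignedPerm-∷⁺ {m} ∣y∣≡ (|w|≡m , inRange , u) =
  cong suc |w|≡m ,
  (subst (1 ≤_) (sym ∣y∣≡) (s≤s z≤n) , ℕ.≤-reflexive ∣y∣≡) ∷ All.map (λ (1≤ , ≤m) → 1≤ , ℕ.m≤n⇒m≤1+n ≤m) inRange ,
  All.map⁺ (All.map (λ (_ , ≤m) ∣y∣≡∣x∣ → ℕ.<-irrefl refl (subst (_≤ m) (trans (sym ∣y∣≡∣x∣) ∣y∣≡) ≤m)) inRange) ∷ u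

-- Inserting ±(m+1)

top bottom : ℕ → ℤ
top    m = + suc m
bottom m = -[1+ m ]

insertions : ℕ → List ℤ → List (List ℤ)
insertions m []       = (top m ∷ []) ∷ (bottom m ∷ []) ∷ []
insertions m (x ∷ xs) = (top m ∷ x ∷ xs) ∷ (bottom m ∷ x ∷ xs) ∷ map (x ∷_) (insertions m xs)

record Insertion (m : ℕ) (w v : List ℤ) : Set where
  constructor insertion
  field
    pre post : List ℤ
    y        : ℤ
    ∣y∣≡1+m  : ∣ y ∣ ≡ suc m
    w≡       : w ≡ pre ++ post
    v≡       : v ≡ pre ++ y ∷ post

∈-insertions⁻ : ∀ m w {v} → v ∈ insertions m w → Insertion m w v
∈-insertions⁻ m []       (here refl)         = insertion [] [] (top m) refl refl refl
∈-insertions⁻ m []       (there (here refl)) = insertion [] [] (bottom m) refl refl refl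
∈-insertions⁻ m (x ∷ xs) (here refl)         = insertion [] (x ∷ xs) (top m) refl refl refl
∈-insertions⁻ m (x ∷ xs) (there (here refl)) = insertion [] (x ∷ xs) (bottom m) refl refl refl
∈-insertions⁻ m (x ∷ xs) (there (there v∈)) with ∈-map⁻ (x ∷_) v∈
... | v′ , v′∈ , refl with ∈-insertions⁻ m xs v′∈
... | insertion pre post y ∣y∣≡ refl refl = insertion (x ∷ pre) post y ∣y∣≡ refl refl

∈-insertions⁺ : ∀ {m} pre post {y} → ∣ y ∣ ≡ suc m → pre ++ y ∷ post ∈ insertions m (pre ++ post)
∈-insertions⁺ []        []      {+ _}       refl = here refl
∈-insertions⁺ []        []      { -[1+ _ ]} refl = there (here refl)
∈-insertions⁺ []        (_ ∷ _) {+ _}       refl = here refl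
∈-insertions⁺ []        (_ ∷ _) { -[1+ _ ]} refl = there (here refl)
∈-insertions⁺ (x ∷ pre) post    ∣y∣≡           = there (there (∈-map⁺ (x ∷_) (∈-insertions⁺ pre post ∣y∣≡)))

insertions-unique : ∀ m {w} → All (Bounded m) w → Unique (insertions m w)
insertions-unique m {[]}     []            = ((λ ()) ∷ []) ∷ [] ∷ []
insertions-unique m {x ∷ xs} (x≤m ∷ xs≤m) =
  ((λ ()) ∷ All.tabulate (∉-later (top m) refl)) ∷
  All.tabulate (∉-later (bottom m) refl) ∷
  Unique.map⁺ List.∷-injectiveʳ (insertions-unique m xs≤m)
  where
  ∉-later : ∀ y → ∣ y ∣ ≡ suc m → ∀ {v} → v ∈ map (x ∷_) (insertions m xs) → y ∷ x ∷ xs ≢ v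
  ∉-later y ∣y∣≡ v∈ eq with ∈-map⁻ (x ∷_) v∈
  ... | _ , _ , refl = ℕ.<-irrefl refl (subst (_≤ m) (trans (cong ∣_∣ (sym (List.∷-injectiveˡ eq))) ∣y∣≡) x≤m)

delete : ℕ → List ℤ → List ℤ
delete m = filter (λ x → ¬? (∣ x ∣ ℕ.≟ suc m))

delete-insertion : ∀ {m w v} → All (Bounded m) w → Insertion m w v → delete m v ≡ w
delete-insertion {m} w≤m (insertion pre post y ∣y∣≡ refl refl) = begin
  delete m (pre ++ y ∷ post)         ≡⟨ List.filter-++ keep? pre (y ∷ post) ⟩
  delete m pre ++ delete m (y ∷ post) ≡⟨ cong (delete m pre ++_) (List.filter-reject keep? {y} {post} (λ ∣y∣≢ → ∣y∣≢ ∣y∣≡)) ⟩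
  delete m pre ++ delete m post       ≡⟨ sym (List.filter-++ keep? pre post) ⟩
  delete m (pre ++ post)             ≡⟨ List.filter-all keep? (All.map (λ ≤m ∣x∣≡ → ℕ.<-irrefl refl (subst (_≤ m) ∣x∣≡ ≤m)) w≤m) ⟩
  pre ++ post                        ∎
  where
  open ≡-Reasoning
  keep? = λ (x : ℤ) → ¬? (∣ x ∣ ℕ.≟ suc m)

IsSignedPerm-∋max : ∀ {m v} → IsSignedPerm (suc m) v → suc m ∈ map ∣_∣ v
IsSignedPerm-∋max {m} {v} (|v|≡ , inRange , u) with suc m ∈? map ∣_∣ v
  where open import Data.List.Membership.DecPropositional ℕ._≟_ using (_∈?_)
... | yes m+1∈ = m+1∈
... | no  m+1∉ = ⊥-elim (ℕ.<-irrefl refl (subst (_≤ m) (trans (List.length-map ∣_∣ v) |v|≡) too-short))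
  where
  too-short : length (map ∣_∣ v) ≤ m
  too-short = pigeonhole m u (narrow (All.tabulate λ a∈ m+1≡a → m+1∉ (subst (_∈ map ∣_∣ v) (sym m+1≡a) a∈)) (All.map⁺ inRange))

signedPerms-suc↭ : ∀ m → signedPerms (suc m) ↭ concatMap (insertions m) (signedPerms m)
signedPerms-suc↭ m = ∼bag⇒↭ (unique∧set⇒bag (signedPerms-unique (suc m)) extensions-unique (mk⇔ extend restrict))
  where
  bounded : ∀ {w} → w ∈ signedPerms m → All (Bounded m) w
  bounded w∈ = All.map proj₂ (proj₁ (proj₂ (∈-signedPerms⁻ m w∈)))

  extensions-unique : Unique (concatMap (insertions m) (signedPerms m))
  extensions-unique = Unique-concatMap⁺ (insertions m) (delete m) (signedPerms-unique m)
    (insertions-unique m ∘ bounded)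
    (λ {w} w∈ v∈ → delete-insertion (bounded w∈) (∈-insertions⁻ m w v∈))

  extend : ∀ {v} → v ∈ signedPerms (suc m) → v ∈ concatMap (insertions m) (signedPerms m)
  extend v∈ with ∈-map⁻ ∣_∣ (IsSignedPerm-∋max (∈-signedPerms⁻ (suc m) v∈))
  ... | y , y∈ , m+1≡∣y∣ with ∈-∃++ y∈
  ... | pre , post , refl = ∈-concatMap⁺ (insertions m) (Any.map (λ { refl → ∈-insertions⁺ pre post (sym m+1≡∣y∣) }) w∈)
    where
    w∈ : pre ++ post ∈ signedPerms m
    w∈ = ∈-signedPerms⁺ m (IsSignedPerm-∷⁻ (sym m+1≡∣y∣) (IsSignedPerm-resp-↭ (shift y pre post) (∈-signedPerms⁻ (suc m) v∈)))

  restrict : ∀ {v} → v ∈ concatMap (insertions m) (signedPerms m) → v ∈ signedPerms (suc m)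
  restrict v∈ with find (∈-concatMap⁻ (insertions m) {xs = signedPerms m} v∈)
  ... | w , w∈ , v∈w with ∈-insertions⁻ m w v∈w
  ... | insertion pre post y ∣y∣≡ refl refl = ∈-signedPerms⁺ (suc m)
    (IsSignedPerm-resp-↭ (↭-sym (shift y pre post)) (IsSignedPerm-∷⁺ ∣y∣≡ (∈-signedPerms⁻ m w∈)))

-- Statistics of an insertion

private
  isYes-true : ∀ {P : Set} (P? : Dec P) → P → isYes P? ≡ true
  isYes-true P? p = trans (isYes≗does P?) (dec-true P? p)

  isYes-false : ∀ {P : Set} (P? : Dec P) → ¬ P → isYes P? ≡ false
  isYes-false P? ¬p = trans (isYes≗does P?) (dec-false P? ¬p)

<-top : ∀ {m} x → Bounded m x → x ℤ.< top m
<-top (+ _)     x≤m = ℤ.+<+ (s≤s x≤m)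
<-top -[1+ _ ] _   = ℤ.-<+

bottom-< : ∀ {m} x → Bounded m x → bottom m ℤ.< x
bottom-< (+ _)     _   = ℤ.-<+
bottom-< -[1+ _ ] x≤m = ℤ.-<- x≤m

module _ {m} x (x≤m : Bounded m x) where

  <top : isYes (x ℤ.<? top m) ≡ true
  <top = isYes-true (x ℤ.<? top m) (<-top x x≤m)

  top≮ : isYes (top m ℤ.<? x) ≡ false
  top≮ = isYes-false (top m ℤ.<? x) (ℤ.<-asym (<-top x x≤m))

  bottom< : isYes (bottom m ℤ.<? x) ≡ true
  bottom< = isYes-true (bottom m ℤ.<? x) (bottom-< x x≤m)

  ≮bottom : isYes (x ℤ.<? bottom m) ≡ false
  ≮bottom = isYes-false (x ℤ.<? bottom m) (ℤ.<-asym (bottom-< x x≤m))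

Bounded-neg : ∀ {m} x → Bounded m x → Bounded m (- x)
Bounded-neg {m} x = subst (_≤ m) (sym (ℤ.∣-i∣≡∣i∣ x))

countB-insert : ∀ p pre y post → countB p (pre ++ y ∷ post) ≡ 𝟙 (p y) + countB p (pre ++ post)
countB-insert p []        y post = refl
countB-insert p (z ∷ pre) y post =
  trans (cong (_+_ (𝟙 (p z))) (countB-insert p pre y post)) (x∙yz≈y∙xz (𝟙 (p z)) (𝟙 (p y)) _)

crossings : ℤ → List ℤ → ℕ
crossings x v = countB (λ y → isYes (y ℤ.<? x)) v + countB (λ y → isYes (y ℤ.<? - x)) v

top-or-bottom : ∀ {m} y → ∣ y ∣ ≡ suc m → y ≡ top m ⊎ y ≡ bottom m
top-or-bottom (+ _)     refl = inj₁ refl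
top-or-bottom -[1+ _ ] refl = inj₂ refl

crossings-insert : ∀ x pre y post → isYes (y ℤ.<? x) ≡ isYes (y ℤ.<? - x) →
                   crossings x (pre ++ y ∷ post) ≡ crossings x (pre ++ post) + 2 * 𝟙 (isYes (y ℤ.<? x))
crossings-insert x pre y post same = begin
  countB p₁ (pre ++ y ∷ post) + countB p₂ (pre ++ y ∷ post)
    ≡⟨ cong₂ _+_ (countB-insert p₁ pre y post) (countB-insert p₂ pre y post) ⟩
  𝟙 (p₁ y) + countB p₁ (pre ++ post) + (𝟙 (p₂ y) + countB p₂ (pre ++ post))
    ≡⟨ cong (λ b → 𝟙 (p₁ y) + countB p₁ (pre ++ post) + (𝟙 b + countB p₂ (pre ++ post))) (sym same) ⟩
  𝟙 (p₁ y) + countB p₁ (pre ++ post) + (𝟙 (p₁ y) + countB p₂ (pre ++ post))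
    ≡⟨ collect (𝟙 (p₁ y)) (countB p₁ (pre ++ post)) (countB p₂ (pre ++ post)) ⟩
  countB p₁ (pre ++ post) + countB p₂ (pre ++ post) + 2 * 𝟙 (p₁ y) ∎
  where
  open ≡-Reasoning
  p₁ p₂ : ℤ → Bool
  p₁ y = isYes (y ℤ.<? x)
  p₂ y = isYes (y ℤ.<? - x)
  collect : ∀ i a b → i + a + (i + b) ≡ a + b + 2 * i
  collect = solve-∀

crossings-insertion : ∀ {m x w v} → Bounded m x → Insertion m w v → ∃ λ j → crossings x v ≡ crossings x w + 2 * j
crossings-insertion {m} {x} x≤m (insertion pre post y ∣y∣≡ refl refl) =
  𝟙 (isYes (y ℤ.<? x)) , crossings-insert x pre y post (same (top-or-bottom y ∣y∣≡))
  where
  same : y ≡ top m ⊎ y ≡ bottom m → isYes (y ℤ.<? x) ≡ isYes (y ℤ.<? - x)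
  same (inj₁ refl) = trans (top≮ x x≤m) (sym (top≮ (- x) (Bounded-neg x x≤m)))
  same (inj₂ refl) = trans (bottom< x x≤m) (sym (bottom< (- x) (Bounded-neg x x≤m)))

countB-<top : ∀ {m w} → All (Bounded m) w → countB (λ y → isYes (y ℤ.<? top m)) w ≡ length w
countB-<top []                        = refl
countB-<top {w = x ∷ _} (x≤m ∷ w≤m) = cong₂ (λ b n → 𝟙 b + n) (<top x x≤m) (countB-<top w≤m)

countB-<bottom : ∀ {m w} → All (Bounded m) w → countB (λ y → isYes (y ℤ.<? bottom m)) w ≡ 0
countB-<bottom []                        = refl
countB-<bottom {w = x ∷ _} (x≤m ∷ w≤m) = cong₂ (λ b n → 𝟙 b + n) (≮bottom x x≤m) (countB-<bottom w≤m)

invB-top∷ : ∀ {m w} → All (Bounded m) w → invB (top m ∷ w) ≡ length w + invB w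
invB-top∷ {m} {w} w≤m = begin
  countB (λ y → isYes (y ℤ.<? top m)) w + countB (λ y → isYes (y ℤ.<? bottom m)) w + 𝟙 (isYes (top m ℤ.<? + 0)) + invB w
    ≡⟨ cong₂ (λ a b → a + b + 𝟙 (isYes (top m ℤ.<? + 0)) + invB w) (countB-<top w≤m) (countB-<bottom w≤m) ⟩
  length w + 0 + 𝟙 (isYes (top m ℤ.<? + 0)) + invB w
    ≡⟨ cong (λ b → length w + 0 + 𝟙 b + invB w) (top≮ {m} (+ 0) z≤n) ⟩
  length w + 0 + 0 + invB w
    ≡⟨ cong (_+ invB w) (trans (ℕ.+-identityʳ _) (ℕ.+-identityʳ _)) ⟩
  length w + invB w ∎
  where open ≡-Reasoning

invB-bottom∷ : ∀ {m w} → All (Bounded m) w → invB (bottom m ∷ w) ≡ suc (length w + invB w)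
invB-bottom∷ {m} {w} w≤m = begin
  countB (λ y → isYes (y ℤ.<? bottom m)) w + countB (λ y → isYes (y ℤ.<? top m)) w + 𝟙 (isYes (bottom m ℤ.<? + 0)) + invB w
    ≡⟨ cong₂ (λ a b → a + b + 𝟙 (isYes (bottom m ℤ.<? + 0)) + invB w) (countB-<bottom w≤m) (countB-<top w≤m) ⟩
  length w + 𝟙 (isYes (bottom m ℤ.<? + 0)) + invB w
    ≡⟨ cong (λ b → length w + 𝟙 b + invB w) (bottom< {m} (+ 0) z≤n) ⟩
  length w + 1 + invB w
    ≡⟨ cong (_+ invB w) (ℕ.+-comm (length w) 1) ⟩
  suc (length w + invB w) ∎
  where open ≡-Reasoning

descents-top∷ : ∀ {m} a x xs → Bounded m a → Bounded m x → descents (a ∷ top m ∷ x ∷ xs) ≡ suc (descents (x ∷ xs))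
descents-top∷ a x xs a≤m x≤m = cong₂ (λ b c → 𝟙 b + (𝟙 c + descents (x ∷ xs))) (top≮ a a≤m) (<top x x≤m)

descents-bottom∷ : ∀ {m} a x xs → Bounded m a → Bounded m x → descents (a ∷ bottom m ∷ x ∷ xs) ≡ suc (descents (x ∷ xs))
descents-bottom∷ a x xs a≤m x≤m = cong₂ (λ b c → 𝟙 b + (𝟙 c + descents (x ∷ xs))) (bottom< a a≤m) (≮bottom x x≤m)

ascents : ℤ → List ℤ → ℕ
ascents a []       = 0
ascents a (x ∷ xs) = 𝟙 (not (isYes (x ℤ.<? a))) + ascents x xs

ascents+descents : ∀ a w → ascents a w + descents (a ∷ w) ≡ length w
ascents+descents a []       = refl
ascents+descents a (x ∷ w) with isYes (x ℤ.<? a)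
... | true  = trans (ℕ.+-suc (ascents x w) (descents (x ∷ w))) (cong suc (ascents+descents x w))
... | false = cong suc (ascents+descents x w)

does-not-≟ : ∀ p s → does (not p Bool.≟ s) ≡ does (p Bool.≟ not s)
does-not-≟ false false = refl
does-not-≟ false true  = refl
does-not-≟ true  false = refl
does-not-≟ true  true  = refl

𝟙-sign-split : ∀ p s q → 𝟙 (does (p Bool.≟ s) ∧ q) + 𝟙 (does (p Bool.≟ not s) ∧ q) ≡ 𝟙 q
𝟙-sign-split false false q = ℕ.+-identityʳ (𝟙 q)
𝟙-sign-split false true  q = refl
𝟙-sign-split true  false q = refl
𝟙-sign-split true  true  q = ℕ.+-identityʳ (𝟙 q)

𝟙-parity-flip : ∀ c n s q → 𝟙 (does (isEven (c + n) Bool.≟ s) ∧ q) + 𝟙 (does (isEven (c + suc n) Bool.≟ s) ∧ q) ≡ 𝟙 q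
𝟙-parity-flip c n s q = begin
  𝟙 (does (p Bool.≟ s) ∧ q) + 𝟙 (does (isEven (c + suc n) Bool.≟ s) ∧ q)
    ≡⟨ cong (λ p′ → 𝟙 (does (p Bool.≟ s) ∧ q) + 𝟙 (does (p′ Bool.≟ s) ∧ q)) (isEven-+suc c n) ⟩
  𝟙 (does (p Bool.≟ s) ∧ q) + 𝟙 (does (not p Bool.≟ s) ∧ q)
    ≡⟨ cong (λ b → 𝟙 (does (p Bool.≟ s) ∧ q) + 𝟙 (b ∧ q)) (does-not-≟ p s) ⟩
  𝟙 (does (p Bool.≟ s) ∧ q) + 𝟙 (does (p Bool.≟ not s) ∧ q)
    ≡⟨ 𝟙-sign-split p s q ⟩
  𝟙 q ∎
  where
  open ≡-Reasoning
  p = isEven (c + n)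

-- Accumulator form of "sign s and k descents": c and e are what a prefix ending in a
-- contributes to inv_B and to des_B.
hasSignDes : (c e : ℕ) (a : ℤ) (s : Bool) (k : ℕ) → List ℤ → Bool
hasSignDes c e a s k v = does (isEven (c + invB v) Bool.≟ s) ∧ (e + descents (a ∷ v) ≡ᵇ k)

hasSignDes-∷ : ∀ {m} c e a s k x {xs v} → Bounded m x → v ∈ insertions m xs →
             hasSignDes c e a s k (x ∷ v)
             ≡ hasSignDes (c + (crossings x xs + 𝟙 (isYes (x ℤ.<? + 0)))) (e + 𝟙 (isYes (x ℤ.<? a))) x s k v
hasSignDes-∷ {m} c e a s k x {xs} {v} x≤m v∈ with crossings-insertion x≤m (∈-insertions⁻ m xs v∈)
... | j , cross≡ = cong₂ _∧_ (cong (λ p → does (p Bool.≟ s)) parity) (cong (_≡ᵇ k) (sym (ℕ.+-assoc e _ _)))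
  where
  i = 𝟙 (isYes (x ℤ.<? + 0))
  regroup : ∀ c κ j i ι → c + (κ + 2 * j + i + ι) ≡ c + (κ + i) + ι + 2 * j
  regroup = solve-∀
  parity : isEven (c + (crossings x v + i + invB v)) ≡ isEven (c + (crossings x xs + i) + invB v)
  parity = begin
    isEven (c + (crossings x v + i + invB v))                 ≡⟨ cong (λ κ → isEven (c + (κ + i + invB v))) cross≡ ⟩
    isEven (c + (crossings x xs + 2 * j + i + invB v))        ≡⟨ cong isEven (regroup c (crossings x xs) j i (invB v)) ⟩
    isEven (c + (crossings x xs + i) + invB v + 2 * j)        ≡⟨ isEven-+2* (c + (crossings x xs + i) + invB v) j ⟩
    isEven (c + (crossings x xs + i) + invB v)                ∎
    where open ≡-Reasoning

descent-merge : ∀ b e D A P Q k →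
  𝟙 (e + suc D ≡ᵇ k) + (𝟙 (e + 𝟙 b + D ≡ᵇ k) * (D + P) + 𝟙 (e + 𝟙 b + suc D ≡ᵇ k) * (A + Q))
  ≡ 𝟙 (e + (𝟙 b + D) ≡ᵇ k) * (𝟙 b + D + P) + 𝟙 (e + suc (𝟙 b + D) ≡ᵇ k) * (𝟙 (not b) + A + Q)
descent-merge true e D A P Q k rewrite ℕ.+-assoc e 1 D | ℕ.+-assoc e 1 (suc D) =
  absorb (𝟙 (e + suc D ≡ᵇ k)) (𝟙 (e + suc (suc D) ≡ᵇ k)) D A P Q
  where
  absorb : ∀ X Y D A P Q → X + (X * (D + P) + Y * (A + Q)) ≡ X * (suc D + P) + Y * (A + Q)
  absorb = solve-∀
descent-merge false e D A P Q k rewrite ℕ.+-identityʳ e =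
  absorb (𝟙 (e + D ≡ᵇ k)) (𝟙 (e + suc D ≡ᵇ k)) D A P Q
  where
  absorb : ∀ X Y D A P Q → Y + (X * (D + P) + Y * (A + Q)) ≡ X * (D + P) + Y * (suc A + Q)
  absorb = solve-∀

count-insertions-[] : ∀ {m} c e a → Bounded m a → ∀ s k →
  count (hasSignDes c e a s k) (insertions m [])
  ≡ 𝟙 (e + 0 ≡ᵇ k) * 𝟙 (does (isEven (c + 0) Bool.≟ s)) + 𝟙 (e + 1 ≡ᵇ k) * 𝟙 (does (isEven (c + 0) Bool.≟ not s))
count-insertions-[] {m} c e a a≤m s k = begin
  𝟙 (stats (top m ∷ [])) + (𝟙 (stats (bottom m ∷ [])) + 0)
    ≡⟨ cong₂ _+_ (cong₂ (λ i d → 𝟙 (does (isEven (c + i) Bool.≟ s) ∧ (e + (𝟙 d + 0) ≡ᵇ k))) (invB-top∷ {m} []) (top≮ a a≤m))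
                 (trans (ℕ.+-identityʳ _)
                        (cong₂ (λ i d → 𝟙 (does (isEven (c + i) Bool.≟ s) ∧ (e + (𝟙 d + 0) ≡ᵇ k))) (invB-bottom∷ {m} []) (bottom< a a≤m))) ⟩
  𝟙 (does (p Bool.≟ s) ∧ (e + 0 ≡ᵇ k)) + 𝟙 (does (isEven (c + 1) Bool.≟ s) ∧ (e + 1 ≡ᵇ k))
    ≡⟨ cong (λ p′ → 𝟙 (does (p Bool.≟ s) ∧ (e + 0 ≡ᵇ k)) + 𝟙 (does (p′ Bool.≟ s) ∧ (e + 1 ≡ᵇ k))) (isEven-+suc c 0) ⟩
  𝟙 (does (p Bool.≟ s) ∧ (e + 0 ≡ᵇ k)) + 𝟙 (does (not p Bool.≟ s) ∧ (e + 1 ≡ᵇ k))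
    ≡⟨ cong₂ _+_ (𝟙-∧ (does (p Bool.≟ s)) (e + 0 ≡ᵇ k)) (trans (𝟙-∧ (does (not p Bool.≟ s)) (e + 1 ≡ᵇ k)) (cong (λ b → 𝟙 (e + 1 ≡ᵇ k) * 𝟙 b) (does-not-≟ p s))) ⟩
  𝟙 (e + 0 ≡ᵇ k) * 𝟙 (does (p Bool.≟ s)) + 𝟙 (e + 1 ≡ᵇ k) * 𝟙 (does (p Bool.≟ not s)) ∎
  where
  open ≡-Reasoning
  stats = hasSignDes c e a s k
  p = isEven (c + 0)
-- Of the two insertions at each gap exactly one has sign s; both keep the descent number at the
-- descents of a ∷ w and raise it at the ascents, while at the end top m keeps and bottom m raises it.
count-insertions : ∀ {m} c e a w → Bounded m a → All (Bounded m) w → ∀ s k →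
  count (hasSignDes c e a s k) (insertions m w)
  ≡ 𝟙 (e + descents (a ∷ w) ≡ᵇ k) * (descents (a ∷ w) + 𝟙 (does (isEven (c + invB w) Bool.≟ s)))
  + 𝟙 (e + suc (descents (a ∷ w)) ≡ᵇ k) * (ascents a w + 𝟙 (does (isEven (c + invB w) Bool.≟ not s)))
count-insertions c e a [] a≤m [] s k = count-insertions-[] c e a a≤m s k
count-insertions {m} c e a (x ∷ xs) a≤m (x≤m ∷ xs≤m) s k = begin
  𝟙 (stats (top m ∷ w)) + (𝟙 (stats (bottom m ∷ w)) + count stats (map (x ∷_) (insertions m xs)))
    ≡⟨ sym (ℕ.+-assoc (𝟙 (stats (top m ∷ w))) _ _) ⟩
  𝟙 (stats (top m ∷ w)) + 𝟙 (stats (bottom m ∷ w)) + count stats (map (x ∷_) (insertions m xs))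
    ≡⟨ cong₂ _+_ extreme-heads later ⟩
  𝟙 (e + suc D ≡ᵇ k) + count (hasSignDes (c + K) (e + t) x s k) (insertions m xs)
    ≡⟨ cong (_+_ (𝟙 (e + suc D ≡ᵇ k))) (count-insertions (c + K) (e + t) x xs x≤m xs≤m s k) ⟩
  𝟙 (e + suc D ≡ᵇ k) + (𝟙 (e + t + D ≡ᵇ k) * (D + 𝟙 (does (p′ Bool.≟ s)))
                       + 𝟙 (e + t + suc D ≡ᵇ k) * (ascents x xs + 𝟙 (does (p′ Bool.≟ not s))))
    ≡⟨ cong (λ q → 𝟙 (e + suc D ≡ᵇ k) + (𝟙 (e + t + D ≡ᵇ k) * (D + 𝟙 (does (q Bool.≟ s)))
                                        + 𝟙 (e + t + suc D ≡ᵇ k) * (ascents x xs + 𝟙 (does (q Bool.≟ not s)))))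
            (cong isEven (ℕ.+-assoc c K (invB xs))) ⟩
  _ ≡⟨ descent-merge (isYes (x ℤ.<? a)) e D (ascents x xs) _ _ k ⟩
  _ ∎
  where
  open ≡-Reasoning
  w = x ∷ xs
  stats = hasSignDes c e a s k
  D = descents (x ∷ xs)
  K = crossings x xs + 𝟙 (isYes (x ℤ.<? + 0))
  t = 𝟙 (isYes (x ℤ.<? a))
  p′ = isEven (c + K + invB xs)

  extreme-heads : 𝟙 (stats (top m ∷ w)) + 𝟙 (stats (bottom m ∷ w)) ≡ 𝟙 (e + suc D ≡ᵇ k)
  extreme-heads = trans
    (cong₂ _+_ (cong₂ (λ i d → 𝟙 (does (isEven (c + i) Bool.≟ s) ∧ (e + d ≡ᵇ k)))
                      (invB-top∷ (x≤m ∷ xs≤m)) (descents-top∷ a x xs a≤m x≤m))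
               (cong₂ (λ i d → 𝟙 (does (isEven (c + i) Bool.≟ s) ∧ (e + d ≡ᵇ k)))
                      (invB-bottom∷ (x≤m ∷ xs≤m)) (descents-bottom∷ a x xs a≤m x≤m)))
    (𝟙-parity-flip c (length w + invB w) s (e + suc D ≡ᵇ k))

  later : count stats (map (x ∷_) (insertions m xs)) ≡ count (hasSignDes (c + K) (e + t) x s k) (insertions m xs)
  later = trans (sumBy-map (𝟙 ∘ stats) (x ∷_) (insertions m xs))
                (sumBy-cong (insertions m xs) (cong 𝟙 ∘ hasSignDes-∷ c e a s k x x≤m))

B : Bool → ℕ → ℕ → ℕ
B s m k = count (hasSignDes 0 0 (+ 0) s k) (signedPerms m)

E : ℕ → ℕ → ℕ
E m k = count (λ w → desB w ≡ᵇ k) (signedPerms m)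

b≡B : ∀ s n k → b s n (+ k) ≡ B s n k
b≡B s n k = length-filter _ (signedPerms n)

b[−1]≡0 : ∀ s n → b s n (+ 0 - + 1) ≡ 0
b[−1]≡0 s n = trans (length-filter _ (signedPerms n)) (count-false _ (signedPerms n) (λ _ → ∧-zeroʳ _))

E≡B+B : ∀ s m k → E m k ≡ B s m k + B (not s) m k
E≡B+B s m k = sym (trans
  (sym (sumBy-+ (𝟙 ∘ hasSignDes 0 0 (+ 0) s k) (𝟙 ∘ hasSignDes 0 0 (+ 0) (not s) k) (signedPerms m)))
  (sumBy-cong (signedPerms m) (λ {w} _ → 𝟙-sign-split (isEven (invB w)) s (desB w ≡ᵇ k))))

ascents≡length∸descents : ∀ a w → ascents a w ≡ length w ∸ descents (a ∷ w)
ascents≡length∸descents a w =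
  trans (sym (ℕ.m+n∸n≡m (ascents a w) (descents (a ∷ w)))) (cong (_∸ descents (a ∷ w)) (ascents+descents a w))

count-insertions-signedPerm : ∀ {m w} → IsSignedPerm m w → ∀ s k →
  count (hasSignDes 0 0 (+ 0) s k) (insertions m w)
  ≡ 𝟙 (desB w ≡ᵇ k) * (desB w + 𝟙 (does (isEven (invB w) Bool.≟ s)))
  + 𝟙 (suc (desB w) ≡ᵇ k) * (m ∸ desB w + 𝟙 (does (isEven (invB w) Bool.≟ not s)))
count-insertions-signedPerm {m} {w} (|w|≡m , inRange , _) s k =
  trans (count-insertions 0 0 (+ 0) w z≤n (All.map proj₂ inRange) s k)
        (cong (λ a → 𝟙 (desB w ≡ᵇ k) * (desB w + 𝟙 (does (isEven (invB w) Bool.≟ s)))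
                     + 𝟙 (suc (desB w) ≡ᵇ k) * (a + 𝟙 (does (isEven (invB w) Bool.≟ not s))))
              (trans (ascents≡length∸descents (+ 0) w) (cong (_∸ desB w) |w|≡m)))

recurrence : ∀ s m k → B s (suc m) k
  ≡ k * E m k + B s m k
  + sumBy (λ w → 𝟙 (suc (desB w) ≡ᵇ k) * (m ∸ desB w + 𝟙 (does (isEven (invB w) Bool.≟ not s)))) (signedPerms m)
recurrence s m k = begin
  count stats (signedPerms (suc m))
    ≡⟨ sumBy-↭ (𝟙 ∘ stats) (signedPerms-suc↭ m) ⟩
  count stats (concatMap (insertions m) (signedPerms m))
    ≡⟨ sumBy-concatMap (𝟙 ∘ stats) (insertions m) (signedPerms m) ⟩
  sumBy (count stats ∘ insertions m) (signedPerms m)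
    ≡⟨ sumBy-cong (signedPerms m) (λ w∈ → count-insertions-signedPerm (∈-signedPerms⁻ m w∈) s k) ⟩
  sumBy (λ w → descentTerm w + ascentTerm w) (signedPerms m)
    ≡⟨ sumBy-+ descentTerm ascentTerm (signedPerms m) ⟩
  sumBy descentTerm (signedPerms m) + sumBy ascentTerm (signedPerms m)
    ≡⟨ cong (_+ sumBy ascentTerm (signedPerms m))
            (sumBy-≡ᵇ-weight desB (λ d → d) (λ w → does (isEven (invB w) Bool.≟ s)) k (signedPerms m)) ⟩
  k * E m k + B s m k + sumBy ascentTerm (signedPerms m) ∎
  where
  open ≡-Reasoning
  stats = hasSignDes 0 0 (+ 0) s k
  descentTerm ascentTerm : List ℤ → ℕ
  descentTerm w = 𝟙 (desB w ≡ᵇ k) * (desB w + 𝟙 (does (isEven (invB w) Bool.≟ s)))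
  ascentTerm  w = 𝟙 (suc (desB w) ≡ᵇ k) * (m ∸ desB w + 𝟙 (does (isEven (invB w) Bool.≟ not s)))

recurrence-zero : ∀ s m → B s (suc m) 0 ≡ B s m 0
recurrence-zero s m = trans (recurrence s m 0)
  (trans (cong (_+_ (B s m 0)) (count-false (λ _ → false) (signedPerms m) (λ _ → refl))) (ℕ.+-identityʳ _))

recurrence-suc : ∀ s m k → B s (suc m) (suc k) ≡ suc k * E m (suc k) + B s m (suc k) + ((m ∸ k) * E m k + B (not s) m k)
recurrence-suc s m k = trans (recurrence s m (suc k))
  (cong (_+_ (suc k * E m (suc k) + B s m (suc k)))
        (sumBy-≡ᵇ-weight desB (m ∸_) (λ w → does (isEven (invB w) Bool.≟ not s)) k (signedPerms m)))

-- Signed differences are binomial coefficients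

[n∸k]*nCk≡[1+k]*nC[1+k] : ∀ n k → (n ∸ k) * (n C k) ≡ suc k * (n C suc k)
[n∸k]*nCk≡[1+k]*nC[1+k] zero    zero    = refl
[n∸k]*nCk≡[1+k]*nC[1+k] zero    (suc k) = sym (ℕ.*-zeroʳ (suc (suc k)))
[n∸k]*nCk≡[1+k]*nC[1+k] (suc n) zero    =
  trans (ℕ.*-identityʳ (suc n)) (trans (sym (nC1≡n (suc n))) (sym (ℕ.+-identityʳ _)))
[n∸k]*nCk≡[1+k]*nC[1+k] (suc n) (suc k)
  rewrite sym (nCk+nC[k+1]≡[n+1]C[k+1] n k) | sym (nCk+nC[k+1]≡[n+1]C[k+1] n (suc k)) with ℕ.<-≤-connex k n
... | inj₁ k<n = begin
  (n ∸ k) * (n C k + n C suc k)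
    ≡⟨ cong (λ d → d * (n C k + n C suc k)) (ℕ.+-∸-assoc 1 k<n) ⟩
  suc (n ∸ suc k) * (n C k + n C suc k)
    ≡⟨ ℕ.*-distribˡ-+ (suc (n ∸ suc k)) (n C k) (n C suc k) ⟩
  suc (n ∸ suc k) * (n C k) + (n C suc k + (n ∸ suc k) * (n C suc k))
    ≡⟨ cong₂ (λ x y → x + (n C suc k + y)) (trans (cong (_* (n C k)) (sym (ℕ.+-∸-assoc 1 k<n))) ([n∸k]*nCk≡[1+k]*nC[1+k] n k))
                                          ([n∸k]*nCk≡[1+k]*nC[1+k] n (suc k)) ⟩
  suc k * (n C suc k) + (n C suc k + suc (suc k) * (n C suc (suc k)))
    ≡⟨ regroup (suc k) (n C suc k) (n C suc (suc k)) ⟩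
  suc (suc k) * (n C suc k + n C suc (suc k)) ∎
  where
  open ≡-Reasoning
  regroup : ∀ a x y → a * x + (x + suc a * y) ≡ suc a * (x + y)
  regroup = solve-∀
... | inj₂ n≤k
  rewrite k>n⇒nCk≡0 (s≤s n≤k) | k>n⇒nCk≡0 (s≤s (ℕ.m≤n⇒m≤1+n n≤k)) | ℕ.m≤n⇒m∸n≡0 n≤k = sym (ℕ.*-zeroʳ (suc (suc k)))

B-empty-suc : ∀ s k → B s 0 (suc k) ≡ 0
B-empty-suc s k = trans (ℕ.+-identityʳ _) (cong 𝟙 (∧-zeroʳ (does (true Bool.≟ s))))

signedDifference-step : ∀ s m k →
  B s m k ≡ B (not s) m k + m C k →
  B (not s) m (suc k) ≡ B s m (suc k) + m C suc k →
  B (not s) (suc m) (suc k) ≡ B s (suc m) (suc k) + suc m C suc k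
signedDifference-step s m k diff₀ diff₁ = begin
  B (not s) (suc m) (suc k)
    ≡⟨ recurrence-suc (not s) m k ⟩
  suc k * E m (suc k) + B (not s) m (suc k) + ((m ∸ k) * E m k + B (not (not s)) m k)
    ≡⟨ cong₂ (λ x y → suc k * E m (suc k) + x + ((m ∸ k) * E m k + y)) diff₁ (trans (cong (λ t → B t m k) (not-involutive s)) diff₀) ⟩
  suc k * E m (suc k) + (B s m (suc k) + m C suc k) + ((m ∸ k) * E m k + (B (not s) m k + m C k))
    ≡⟨ regroup (suc k * E m (suc k)) (B s m (suc k)) ((m ∸ k) * E m k) (B (not s) m k) (m C k) (m C suc k) ⟩
  suc k * E m (suc k) + B s m (suc k) + ((m ∸ k) * E m k + B (not s) m k) + (m C k + m C suc k)
    ≡⟨ cong₂ _+_ (sym (recurrence-suc s m k)) (nCk+nC[k+1]≡[n+1]C[k+1] m k) ⟩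
  B s (suc m) (suc k) + suc m C suc k ∎
  where
  open ≡-Reasoning
  regroup : ∀ a x b y c₀ c₁ → a + (x + c₁) + (b + (y + c₀)) ≡ a + x + (b + y) + (c₀ + c₁)
  regroup = solve-∀

signedDifference : ∀ m k → B (isEven k) m k ≡ B (not (isEven k)) m k + m C k
signedDifference zero    zero    = refl
signedDifference zero    (suc k) =
  trans (B-empty-suc (isEven (suc k)) k) (sym (trans (ℕ.+-identityʳ _) (B-empty-suc (not (isEven (suc k))) k)))
signedDifference (suc m) zero    =
  trans (recurrence-zero true m) (trans (signedDifference m zero) (cong (_+ 1) (sym (recurrence-zero false m))))
signedDifference (suc m) (suc k) with signedDifference m k | signedDifference m (suc k)
... | diff₀ | diff₁ rewrite isEven-suc k | not-involutive (isEven k) = signedDifference-step (isEven k) m k diff₀ diff₁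

balance-shift : ∀ a d x y c₀ c₁ → d * c₀ ≡ a * c₁ → a * x + d * (y + c₀) ≡ a * (x + c₁) + d * y
balance-shift a d x y c₀ c₁ dc₀≡ac₁ = begin
  a * x + d * (y + c₀)     ≡⟨ expand a d x y c₀ ⟩
  a * x + d * y + d * c₀   ≡⟨ cong (_+_ (a * x + d * y)) dc₀≡ac₁ ⟩
  a * x + d * y + a * c₁   ≡⟨ collect a d x y c₁ ⟩
  a * (x + c₁) + d * y     ∎
  where
  open ≡-Reasoning
  expand : ∀ a d x y c₀ → a * x + d * (y + c₀) ≡ a * x + d * y + d * c₀
  expand = solve-∀
  collect : ∀ a d x y c₁ → a * x + d * y + a * c₁ ≡ a * (x + c₁) + d * y
  collect = solve-∀

balance-oriented : ∀ s m k →
  B s m k ≡ B (not s) m k + m C k → B (not s) m (suc k) ≡ B s m (suc k) + m C suc k →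
  suc k * B s m (suc k) + (m ∸ k) * B s m k ≡ suc k * B (not s) m (suc k) + (m ∸ k) * B (not s) m k
balance-oriented s m k diff₀ diff₁ = begin
  suc k * B s m (suc k) + (m ∸ k) * B s m k
    ≡⟨ cong (λ x → suc k * B s m (suc k) + (m ∸ k) * x) diff₀ ⟩
  suc k * B s m (suc k) + (m ∸ k) * (B (not s) m k + m C k)
    ≡⟨ balance-shift (suc k) (m ∸ k) _ _ (m C k) (m C suc k) ([n∸k]*nCk≡[1+k]*nC[1+k] m k) ⟩
  suc k * (B s m (suc k) + m C suc k) + (m ∸ k) * B (not s) m k
    ≡⟨ cong (λ x → suc k * x + (m ∸ k) * B (not s) m k) (sym diff₁) ⟩
  suc k * B (not s) m (suc k) + (m ∸ k) * B (not s) m k ∎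
  where open ≡-Reasoning

balance : ∀ s m k → suc k * B s m (suc k) + (m ∸ k) * B s m k ≡ suc k * B (not s) m (suc k) + (m ∸ k) * B (not s) m k
balance s m k
  with signedDifference m k | subst (λ t → B t m (suc k) ≡ B (not t) m (suc k) + m C suc k) (isEven-suc k) (signedDifference m (suc k))
... | diff₀ | diff₁ with isEven k | s
... | true  | true  = balance-oriented true m k diff₀ diff₁
... | false | false = balance-oriented false m k diff₀ diff₁
... | true  | false = sym (balance-oriented true m k diff₀ diff₁)
... | false | true  = sym (balance-oriented false m k diff₀ diff₁)

rearrange : ∀ a d X Y X′ Y′ → a * X + d * X′ ≡ a * Y + d * Y′ →
  a * (X + Y) + X + (d * (X′ + Y′) + Y′) ≡ 2 * a * Y + (2 * d + 1) * Y′ + X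
rearrange a d X Y X′ Y′ balanced = begin
  a * (X + Y) + X + (d * (X′ + Y′) + Y′)        ≡⟨ split a d X Y X′ Y′ ⟩
  (a * X + d * X′) + (a * Y + d * Y′ + Y′ + X)   ≡⟨ cong (_+ (a * Y + d * Y′ + Y′ + X)) balanced ⟩
  (a * Y + d * Y′) + (a * Y + d * Y′ + Y′ + X)   ≡⟨ merge a d X Y Y′ ⟩
  2 * a * Y + (2 * d + 1) * Y′ + X              ∎
  where
  open ≡-Reasoning
  split : ∀ a d X Y X′ Y′ → a * (X + Y) + X + (d * (X′ + Y′) + Y′) ≡ (a * X + d * X′) + (a * Y + d * Y′ + Y′ + X)
  split = solve-∀
  merge : ∀ a d X Y Y′ → (a * Y + d * Y′) + (a * Y + d * Y′ + Y′ + X) ≡ 2 * a * Y + (2 * d + 1) * Y′ + X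
  merge = solve-∀

b-recurrence : ∀ s m k →
  b s (suc m) (+ k) ≡ 2 * k * b (not s) m (+ k) + (2 * suc m ∸ 2 * k + 1) * b (not s) m (+ k - + 1) + b s m (+ k)
b-recurrence s m zero = begin
  b s (suc m) (+ 0)                       ≡⟨ b≡B s (suc m) 0 ⟩
  B s (suc m) 0                           ≡⟨ recurrence-zero s m ⟩
  B s m 0                                 ≡⟨ sym (b≡B s m 0) ⟩
  b s m (+ 0)                             ≡⟨ cong (_+ b s m (+ 0)) (sym (ℕ.*-zeroʳ c)) ⟩
  c * 0 + b s m (+ 0)                     ≡⟨ cong (λ x → c * x + b s m (+ 0)) (sym (b[−1]≡0 (not s) m)) ⟩
  c * b (not s) m (+ 0 - + 1) + b s m (+ 0) ∎
  where
  open ≡-Reasoning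
  c = 2 * suc m ∸ 2 * 0 + 1
b-recurrence s m (suc k) = begin
  b s (suc m) (+ suc k)
    ≡⟨ b≡B s (suc m) (suc k) ⟩
  B s (suc m) (suc k)
    ≡⟨ recurrence-suc s m k ⟩
  suc k * E m (suc k) + B s m (suc k) + ((m ∸ k) * E m k + B (not s) m k)
    ≡⟨ cong₂ (λ e e′ → suc k * e + B s m (suc k) + ((m ∸ k) * e′ + B (not s) m k)) (E≡B+B s m (suc k)) (E≡B+B s m k) ⟩
  suc k * (B s m (suc k) + B (not s) m (suc k)) + B s m (suc k) + ((m ∸ k) * (B s m k + B (not s) m k) + B (not s) m k)
    ≡⟨ rearrange (suc k) (m ∸ k) _ _ _ _ (balance s m k) ⟩
  2 * suc k * B (not s) m (suc k) + (2 * (m ∸ k) + 1) * B (not s) m k + B s m (suc k)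
    ≡⟨ cong (λ c → 2 * suc k * B (not s) m (suc k) + (c + 1) * B (not s) m k + B s m (suc k)) (ℕ.*-distribˡ-∸ 2 (suc m) (suc k)) ⟩
  2 * suc k * B (not s) m (suc k) + (2 * suc m ∸ 2 * suc k + 1) * B (not s) m k + B s m (suc k)
    ≡⟨ sym (cong₂ (λ x y → 2 * suc k * x + (2 * suc m ∸ 2 * suc k + 1) * y + B s m (suc k)) (b≡B (not s) m (suc k)) (b≡B (not s) m k)) ⟩
  2 * suc k * b (not s) m (+ suc k) + (2 * suc m ∸ 2 * suc k + 1) * b (not s) m (+ suc k - + 1) + B s m (suc k)
    ≡⟨ cong (_+_ (2 * suc k * b (not s) m (+ suc k) + (2 * suc m ∸ 2 * suc k + 1) * b (not s) m (+ suc k - + 1))) (sym (b≡B s m (suc k))) ⟩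
  2 * suc k * b (not s) m (+ suc k) + (2 * suc m ∸ 2 * suc k + 1) * b (not s) m (+ suc k - + 1) + b s m (+ suc k) ∎
  where open ≡-Reasoning

corollary31 : (n k : ℕ) → 2 ≤ n → k ≤ n →
    (b⁺ n (+ k) ≡ 2 * k * b⁻ (n ∸ 1) (+ k) + (2 * n ∸ 2 * k + 1) * b⁻ (n ∸ 1) (+ k - + 1) + b⁺ (n ∸ 1) (+ k))
    × (b⁻ n (+ k) ≡ 2 * k * b⁺ (n ∸ 1) (+ k) + (2 * n ∸ 2 * k + 1) * b⁺ (n ∸ 1) (+ k - + 1) + b⁻ (n ∸ 1) (+ k))
-- The recurrence holds for all n ≥ 1 and all k.
corollary31 (suc m) k _ _ = b-recurrence true m k , b-recurrence false m k
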